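{- Let $n$ be even, $r\geq1$, $V=\{1,\dots,n\}$, $R=\{n+1,\dots,n+r\}$, $V^R=V\cup R$, let $A^R=(a_{ij})_{i,j\in V^R}$ be skew-symmetric with $\sum_{j\in V^R}a_{ij}=0$ for all $i$, and let $G^R$, $G$ be the associated graphs. Let $\mathcal{F}$ be the set of spanning forests of $G^R$ all of whose trimming-algorithm paths have even length, and for a perfect matching $M_0$ of $G$ let $\mathcal{F}(M_0)$ be the set of spanning forests of $G^R$ compatible with $M_0$ all of whose trimming-algorithm paths start with an edge of $M_0$ and have even length. Then $$\mathcal{F}=\bigcup_{M_0\in\mathcal{M}}\mathcal{F}(M_0),$$ where $\mathcal{M}$ is the set of perfect matchings of $G$.
   Context: $G^R$ has vertex set $V^R$ and an edge $ij$ ($i\neq j$) whenever $a_{ij}\neq0$; $G$ is its induced subgraph on $V$. A perfect matching of $G$ is a set of edges of $G$ covering each vertex of $V$ exactly once. A spanning forest of $G^R$ is a set $F$ of oriented edges of $G^R$ such that every vertex of $V$ is the tail of exactly one edge of $F$, no vertex of $R$ is a tail, and $F$ contains no cycle. $F$ is compatible with $M_0$ if it contains all $n/2$ edges of $M_0$ (in some orientation) and $n/2$ edges not in $M_0$. Trimming algorithm (applied to any spanning forest $F$): $F_1=F$; at step $i$, a leaf of $F_i$ is a vertex that is a tail but not a head of an edge of $F_i$; let $\ell^i$ be the largest leaf; follow outgoing edges of $F_i$ from $\ell^i$ and stop at the first subsequent vertex that is in $R$, or is the head of at least two edges of $F_i$, or has label smaller than $\ell^i$; this gives a path $\lambda_{\ell^i}$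 of length $\geq1$; $F_{i+1}=F_i\setminus\lambda_{\ell^i}$; stop when empty, after $N$ steps, giving paths $\lambda_{\ell^1},\dots,\lambda_{\ell^N}$. -}

module Defs where

open import Level using (Level)
open import Algebra.Bundles using (CommutativeRing)
open import Data.Bool.Base using (Bool; true; false; _∧_; _∨_; not; if_then_else_)
open import Data.Nat.Base using (ℕ; zero; suc; _<ᵇ_; _≤ᵇ_; _+_; _/_)
open import Data.Nat.Divisibility using (_∣_)
open import Data.Fin.Base using (Fin; toℕ; _↑ˡ_; splitAt)
open import Data.Fin.Properties using (_≟_)
open import Data.List.Base using (List; []; _∷_; length; filter; last; allFin)
open import Data.List.Relation.Unary.All using (All)
open import Data.Maybe.Base using (Maybe; just; nothing)
open import Data.Sum.Base using (inj₁; inj₂)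
open import Data.Product.Base using (_×_; Σ)
open import Relation.Nullary.Decidable.Core using (⌊_⌋; ¬?; T?)
open import Relation.Nullary.Negation.Core using (¬_)
open import Relation.Binary.PropositionalEquality.Core using (_≡_; _≢_)
open import Data.Bool.Base using (T)

-- Vertices: Fin (n + r).  Index i < n  is the paper's vertex i+1 ∈ V,
-- index n + k is the paper's vertex n+k+1 ∈ R.  Labels are compared via toℕ
-- (order preserving shift of the paper's labels).
--
-- A spanning forest F of G^R (every vertex of V is the tail of exactly one
-- edge, no vertex of R is a tail) is encoded by its "head" function
--   f : Fin n → Fin (n + r),   the edge with tail i being  i → f i.
-- The edges of F are identified with their tails (elements of Fin n).

module Forest (n r : ℕ) (f : Fin n → Fin (n + r)) where

  emb : Fin n → Fin (n + r)
  emb = (_↑ˡ r)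

  _==_ : {m : ℕ} → Fin m → Fin m → Bool
  x == y = ⌊ x ≟ y ⌋

  step : Fin (n + r) → Fin (n + r)
  step w with splitAt n w
  ... | inj₁ v = f v
  ... | inj₂ _ = w

  iter : ℕ → Fin (n + r) → Fin (n + r)
  iter zero    w = w
  iter (suc k) w = iter k (step w)

  Acyclic : Set
  Acyclic = (i : Fin n) (k : ℕ) → iter (suc k) (emb i) ≢ emb i

  -- current edge set F_i: the set of tails of edges still present
  Alive : Set
  Alive = Fin n → Bool

  headCount : Alive → Fin (n + r) → ℕ
  headCount al w = length (filter (λ u → T? (al u ∧ (f u == w))) (allFin n))

  isLeaf : Alive → Fin n → Bool
  isLeaf al v = al v ∧ (headCount al (emb v) ≤ᵇ 0)

  largestLeaf : Alive → Maybe (Fin n)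
  largestLeaf al = last (filter (λ v → T? (isLeaf al v)) (allFin n))

  -- follow outgoing edges from the leaf ℓ; returns the tails of the
  -- edges of the path after the first one.  w is the current vertex.
  -- Stop at w if w ∈ R, or w is head of ≥ 2 edges of F_i, or label w < ℓ
  -- (or, defensively, if the outgoing edge of w is no longer in F_i).
  follow : ℕ → Alive → Fin n → Fin (n + r) → List (Fin n)
  follow zero    al ℓ w = []
  follow (suc k) al ℓ w with splitAt n w
  ... | inj₂ _ = []
  ... | inj₁ v =
        if (2 ≤ᵇ headCount al w) ∨ (toℕ v <ᵇ toℕ ℓ) ∨ not (al v)
        then []
        else v ∷ follow k al ℓ (f v)

  -- the path λ_ℓ, as the list of tails of its edges (in order); its
  -- length (number of edges) is the length of this list, ≥ 1.
  pathFrom : Alive → Fin n → List (Fin n)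
  pathFrom al ℓ = ℓ ∷ follow n al ℓ (f ℓ)

  remove : List (Fin n) → Alive → Alive
  remove []       al = al
  remove (v ∷ vs) al u = if u == v then false else remove vs al u

  -- the trimming algorithm, with fuel (each step removes ≥ 1 of the n edges)
  trimWith : ℕ → Alive → List (List (Fin n))
  trimWith zero    al = []
  trimWith (suc k) al with largestLeaf al
  ... | nothing = []
  ... | just ℓ  = let p = pathFrom al ℓ in p ∷ trimWith k (remove p al)

  trimPaths : List (List (Fin n))
  trimPaths = trimWith n (λ _ → true)

  AllPathsEven : Set
  AllPathsEven = All (λ p → 2 ∣ length p) trimPaths

module Graphs {c ℓ : Level} (K : CommutativeRing c ℓ) where
  open CommutativeRing K renaming (_+_ to _⊕_)

  sumFin : (m : ℕ) → (Fin m → Carrier) → Carrier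
  sumFin zero    g = 0#
  sumFin (suc m) g = g Fin.zero ⊕ sumFin m (λ j → g (Fin.suc j))
    where import Data.Fin.Base as Fin

  SkewSymmetric : {N : ℕ} → (Fin N → Fin N → Carrier) → Set ℓ
  SkewSymmetric a = ∀ i j → a i j ≈ - a j i

  ZeroRowSums : {N : ℕ} → (Fin N → Fin N → Carrier) → Set ℓ
  ZeroRowSums {N} a = ∀ i → sumFin N (a i) ≈ 0#

  Edge : {N : ℕ} → (Fin N → Fin N → Carrier) → Fin N → Fin N → Set ℓ
  Edge a i j = (i ≢ j) × ¬ (a i j ≈ 0#)

  module _ (n r : ℕ) (a : Fin (n + r) → Fin (n + r) → Carrier) where

    emb : Fin n → Fin (n + r)
    emb = (_↑ˡ r)

    SpanningForest : (Fin n → Fin (n + r)) → Set ℓ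
    SpanningForest f = ((i : Fin n) → Edge a (emb i) (f i)) × Forest.Acyclic n r f

    -- a perfect matching of G, encoded by the partner function m
    -- (edge {i, m i}; each vertex of V covered exactly once)
    PerfectMatching : (Fin n → Fin n) → Set ℓ
    PerfectMatching m =
      ((i : Fin n) → Edge a (emb i) (emb (m i))) × ((i : Fin n) → m (m i) ≡ i)

    nonMatchingEdges : (Fin n → Fin n) → (Fin n → Fin (n + r)) → ℕ
    nonMatchingEdges m f = length (filter (λ i → ¬? (f i ≟ emb (m i))) (allFin n))

    -- F compatible with M₀: all n/2 edges of M₀ (in some orientation) and
    -- n/2 edges not in M₀
    Compatible : (Fin n → Fin n) → (Fin n → Fin (n + r)) → Set
    Compatible m f =
      ((i : Fin n) → (f i ≡ emb (m i)) Data.Sum.Base.⊎ (f (m i) ≡ emb i))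
      × nonMatchingEdges m f ≡ n / 2
      where import Data.Sum.Base

    StartsInM : (Fin n → Fin n) → (Fin n → Fin (n + r)) → List (Fin n) → Set
    StartsInM m f []      = Data.Empty.⊥ where import Data.Empty
    StartsInM m f (ℓ₀ ∷ _) = f ℓ₀ ≡ emb (m ℓ₀)

    InF : (Fin n → Fin (n + r)) → Set ℓ
    InF f = SpanningForest f × Forest.AllPathsEven n r f

    InFM : (Fin n → Fin n) → (Fin n → Fin (n + r)) → Set ℓ
    InFM m f = SpanningForest f × Compatible m f
               × All (StartsInM m f) (Forest.trimPaths n r f)
               × Forest.AllPathsEven n r f

-- The inclusion 𝓕(M₀) ⊆ 𝓕 is a projection.  For 𝓕 ⊆ ⋃ 𝓕(M₀), let F be a
-- spanning forest all of whose trimming paths have even length.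
--  * Trimming facts: every trimming path is a chain of consecutive edges of F;
--    chains of an acyclic F are duplicate-free; and the paths together
--    partition the n edges of F.  The algorithm never stops early because,
--    while an edge is left, a leaf exists: otherwise walking backwards along
--    edges forever would close a cycle (pigeonhole).
--  * Cutting every even path into consecutive pairs (x , y), where the edge
--    of x ends at the tail y, gives disjoint pairs covering V.
--  * Pair matching: exchanging the entries of each pair is a perfect matching
--    M₀ of G (edges are symmetric by skew-symmetry); x → y lies in F and in
--    M₀, y's edge is not in M₀ (it would close a 2-cycle), so F is compatible
--    with M₀ with exactly n/2 non-matching edges, and every path starts with a
--    matching edge.
module Submission where

open import Defs
open import Level using (Level)
open import Algebra.Bundles using (CommutativeRing)
open import Data.Nat.Base using (ℕ; _≤_; _+_)
open import Data.Nat.Divisibility using (_∣_)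
open import Data.Fin.Base using (Fin)
open import Data.Product.Base using (_×_; Σ)

open import Data.Nat.Base using (zero; suc; _*_; _∸_; _<_; _/_; _≤ᵇ_; _<ᵇ_)
open import Data.Nat.Properties using (n<1+n; ≤-pred; ≤-trans; +-suc; m∸n+n≡m)
open import Data.Nat.Divisibility using (∣1⇒≡1; ∣m+n∣m⇒∣n; ∣-refl)
open import Data.Nat.DivMod using (m*n/n≡m)
open import Data.Fin.Base using (toℕ; splitAt)
open import Data.Fin.Properties using (_≟_; splitAt-↑ˡ; splitAt⁻¹-↑ˡ; pigeonhole)
open import Data.Fin.Subset using (Subset; ∣_∣) renaming (_∈_ to _∈ₛ_)
open import Data.Fin.Subset.Properties using (p⊂q⇒∣p∣<∣q∣; ∣p∣≤n; ∣⊥∣≡0; ⊥⊆; ∉⊥)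
open import Data.Vec.Base using (tabulate)
open import Data.Vec.Properties using (lookup∘tabulate; []=⇒lookup; lookup⇒[]=)
open import Data.Bool.Base using (true; false; _∧_; _∨_; not; T)
open import Data.Bool.Properties using (T-∧; T-≡)
open import Data.Unit.Base using (tt)
open import Data.Empty using (⊥; ⊥-elim)
open import Data.Sum.Base using (_⊎_; inj₁; inj₂)
open import Data.Product.Base using (_,_; proj₁; proj₂; ∃)
open import Data.Maybe.Base using (just; nothing)
open import Data.List.Base using (List; []; _∷_; _++_; length; filter; last; allFin; concat)
open import Data.List.Properties using (length-tabulate; filter-accept; filter-reject)
open import Data.List.Membership.Propositional using (_∈_)
open import Data.List.Membership.Propositional.Properties
  using (∈-filter⁺; ∈-filter⁻; ∈-allFin; ∈-++⁺ˡ; ∈-++⁺ʳ)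
open import Data.List.Membership.Propositional.Properties.WithK using (unique∧set⇒bag)
open import Data.List.Relation.Binary.BagAndSetEquality using (∼bag⇒↭)
open import Data.List.Relation.Binary.Permutation.Propositional using (_↭_; ↭-sym)
open import Data.List.Relation.Binary.Permutation.Propositional.Properties using (filter-↭; ↭-length)
open import Data.List.Relation.Unary.Any using (here; there)
open import Data.List.Relation.Unary.All as All using (All; []; _∷_)
open import Data.List.Relation.Unary.All.Properties using (++⁺)
open import Data.List.Relation.Unary.Unique.Propositional using (Unique)
open import Data.List.Relation.Unary.Unique.Propositional.Properties
  using (allFin⁺) renaming (++⁺ to unique-++⁺)
open import Data.List.Relation.Unary.AllPairs using ([]; _∷_)
open import Function.Base using (_∘_)
open import Function.Bundles using (Equivalence; mk⇔)
open import Relation.Nullary using (yes; no; ¬_; ¬?)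
open import Relation.Nullary.Decidable.Core using (T?; toWitness)
open import Relation.Unary using (Decidable)
open import Relation.Binary.PropositionalEquality
  using (_≡_; _≢_; refl; sym; trans; cong; subst; module ≡-Reasoning)

open Equivalence using (to; from)

-- Two duplicate-free lists with the same elements are permutations of each
-- other; used to count along the pairing instead of along allFin.
unique-same-elements-↭ : {A : Set} {xs ys : List A} → Unique xs → Unique ys →
  (∀ {z} → z ∈ xs → z ∈ ys) → (∀ {z} → z ∈ ys → z ∈ xs) → xs ↭ ys
unique-same-elements-↭ xs! ys! xs⊆ys ys⊆xs = ∼bag⇒↭ (unique∧set⇒bag xs! ys! (mk⇔ xs⊆ys ys⊆xs))

last-∈ : {A : Set} (xs : List A) {x : A} → last xs ≡ just x → x ∈ xs
last-∈ (y ∷ []) refl = here refl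
last-∈ (y ∷ z ∷ xs) e = there (last-∈ (z ∷ xs) e)

last-nothing : {A : Set} (xs : List A) → last xs ≡ nothing → xs ≡ []
last-nothing [] e = refl
last-nothing (y ∷ []) ()
last-nothing (y ∷ z ∷ xs) e with () ← last-nothing (z ∷ xs) e

-- Cutting lists into consecutive pairs

module Pairing {A : Set} where

  -- x₁ x₂ x₃ x₄ … ↦ (x₁ , x₂) (x₃ , x₄) …  (an odd last element is dropped)
  pairsOf : List A → List (A × A)
  pairsOf (x ∷ y ∷ xs) = (x , y) ∷ pairsOf xs
  pairsOf _ = []

  pairsAll : List (List A) → List (A × A)
  pairsAll [] = []
  pairsAll (xs ∷ xss) = pairsOf xs ++ pairsAll xss

  flat : List (A × A) → List A
  flat [] = []
  flat ((x , y) ∷ ps) = x ∷ y ∷ flat ps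

  flat-++ : (ps qs : List (A × A)) → flat (ps ++ qs) ≡ flat ps ++ flat qs
  flat-++ [] qs = refl
  flat-++ ((x , y) ∷ ps) qs = cong (λ zs → x ∷ y ∷ zs) (flat-++ ps qs)

  even-drop-two : (xs : List A) {x y : A} → 2 ∣ length (x ∷ y ∷ xs) → 2 ∣ length xs
  even-drop-two xs even = ∣m+n∣m⇒∣n even (∣-refl {2})

  flat-pairsOf : (xs : List A) → 2 ∣ length xs → flat (pairsOf xs) ≡ xs
  flat-pairsOf [] even = refl
  flat-pairsOf (x ∷ []) even with () ← ∣1⇒≡1 even
  flat-pairsOf (x ∷ y ∷ xs) even =
    cong (λ zs → x ∷ y ∷ zs) (flat-pairsOf xs (even-drop-two xs {x} {y} even))

  flat-pairsAll : (xss : List (List A)) → All (λ xs → 2 ∣ length xs) xss →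
    flat (pairsAll xss) ≡ concat xss
  flat-pairsAll [] [] = refl
  flat-pairsAll (xs ∷ xss) (even ∷ evens) = begin
    flat (pairsOf xs ++ pairsAll xss)       ≡⟨ flat-++ (pairsOf xs) (pairsAll xss) ⟩
    flat (pairsOf xs) ++ flat (pairsAll xss) ≡⟨ cong (_++ _) (flat-pairsOf xs even) ⟩
    xs ++ flat (pairsAll xss)               ≡⟨ cong (xs ++_) (flat-pairsAll xss evens) ⟩
    xs ++ concat xss                        ∎
    where open ≡-Reasoning

  pairsOf⊆pairsAll : (xss : List (List A)) {xs : List A} → xs ∈ xss →
    ∀ {pr} → pr ∈ pairsOf xs → pr ∈ pairsAll xss
  pairsOf⊆pairsAll (ys ∷ xss) (here refl) pr∈ = ∈-++⁺ˡ pr∈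
  pairsOf⊆pairsAll (ys ∷ xss) (there xs∈) pr∈ = ∈-++⁺ʳ (pairsOf ys) (pairsOf⊆pairsAll xss xs∈ pr∈)

  length-flat : (ps : List (A × A)) → length (flat ps) ≡ length ps * 2
  length-flat [] = refl
  length-flat (_ ∷ ps) = cong (suc ∘ suc) (length-flat ps)

  ∈-flat⁻ : (ps : List (A × A)) {i : A} → i ∈ flat ps →
    Σ (A × A) λ pr → pr ∈ ps × (i ≡ proj₁ pr ⊎ i ≡ proj₂ pr)
  ∈-flat⁻ ((x , y) ∷ ps) (here i≡x) = (x , y) , here refl , inj₁ i≡x
  ∈-flat⁻ ((x , y) ∷ ps) (there (here i≡y)) = (x , y) , here refl , inj₂ i≡y
  ∈-flat⁻ ((x , y) ∷ ps) (there (there i∈)) with ∈-flat⁻ ps i∈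
  ... | pr , pr∈ , side = pr , there pr∈ , side

  ∈-flat⁺ : (ps : List (A × A)) {x y : A} → (x , y) ∈ ps → x ∈ flat ps × y ∈ flat ps
  ∈-flat⁺ (_ ∷ ps) (here refl) = here refl , there (here refl)
  ∈-flat⁺ (_ ∷ ps) (there pr∈) with ∈-flat⁺ ps pr∈
  ... | x∈ , y∈ = there (there x∈) , there (there y∈)

  length-filter-flat : {P : A → Set} (P? : Decidable P) (ps : List (A × A)) →
    All (λ pr → ¬ P (proj₁ pr) × P (proj₂ pr)) ps → length (filter P? (flat ps)) ≡ length ps
  length-filter-flat P? [] [] = refl
  length-filter-flat P? ((x , y) ∷ ps) ((¬Px , Py) ∷ rest)
    rewrite filter-reject P? {x} {y ∷ flat ps} ¬Px | filter-accept P? {y} {flat ps} Py =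
    cong suc (length-filter-flat P? ps rest)

open Pairing

-- The involution exchanging the entries of disjoint pairs

-- identity outside the pairs; on a pair the first match wins
partner : {k : ℕ} → List (Fin k × Fin k) → Fin k → Fin k
partner [] i = i
partner ((x , y) ∷ ps) i with i ≟ x | i ≟ y
... | yes _ | _     = y
... | no _  | yes _ = x
... | no _  | no _  = partner ps i

partner-first : {k : ℕ} (x y : Fin k) (ps : List (Fin k × Fin k)) → partner ((x , y) ∷ ps) x ≡ y
partner-first x y ps with x ≟ x | x ≟ y
... | yes _   | _ = refl
... | no x≢x  | _ = ⊥-elim (x≢x refl)

partner-second : {k : ℕ} (x y : Fin k) (ps : List (Fin k × Fin k)) → x ≢ y →
  partner ((x , y) ∷ ps) y ≡ x
partner-second x y ps x≢y with y ≟ x | y ≟ y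
... | yes y≡x | _       = ⊥-elim (x≢y (sym y≡x))
... | no _    | yes _   = refl
... | no _    | no y≢y  = ⊥-elim (y≢y refl)

partner-skip : {k : ℕ} (x y : Fin k) (ps : List (Fin k × Fin k)) {i : Fin k} → x ≢ i → y ≢ i →
  partner ((x , y) ∷ ps) i ≡ partner ps i
partner-skip x y ps {i} x≢i y≢i with i ≟ x | i ≟ y
... | yes i≡x | _       = ⊥-elim (x≢i (sym i≡x))
... | no _    | yes i≡y = ⊥-elim (y≢i (sym i≡y))
... | no _    | no _    = refl

partner-pair : {k : ℕ} (ps : List (Fin k × Fin k)) → Unique (flat ps) →
  ∀ {x y} → (x , y) ∈ ps → partner ps x ≡ y × partner ps y ≡ x
partner-pair ((x , y) ∷ ps) ((x≢y ∷ _) ∷ _) (here refl) =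
  partner-first x y ps , partner-second x y ps x≢y
partner-pair ((a , b) ∷ ps) ((_ ∷ a∉) ∷ (b∉ ∷ ps!)) {x} {y} (there pr∈)
  with ∈-flat⁺ ps pr∈ | partner-pair ps ps! pr∈
... | x∈ , y∈ | to-y , to-x =
  trans (partner-skip a b ps (All.lookup a∉ x∈) (All.lookup b∉ x∈)) to-y ,
  trans (partner-skip a b ps (All.lookup a∉ y∈) (All.lookup b∉ y∈)) to-x

-- Chains of edges of the forest encoded by f, and the behaviour of the
-- trimming algorithm; acyclicity is assumed only where needed

module Trimming (n r : ℕ) (f : Fin n → Fin (n + r)) where
  open Forest n r f

  step-emb : ∀ v → step (emb v) ≡ f v
  step-emb v rewrite splitAt-↑ˡ n v r = refl

  data Chain : Fin (n + r) → List (Fin n) → Set where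
    []  : ∀ {w} → Chain w []
    _∷_ : ∀ {w v vs} → emb v ≡ w → Chain (f v) vs → Chain w (v ∷ vs)

  IsPath : List (Fin n) → Set
  IsPath []       = ⊥
  IsPath (ℓ ∷ vs) = Chain (f ℓ) vs

  Linked : Fin n × Fin n → Set
  Linked (x , y) = f x ≡ emb y

  chain-reach : ∀ {w vs z} → Chain w vs → z ∈ vs → ∃ λ k → iter k w ≡ emb z
  chain-reach (e ∷ _) (here refl) = 0 , sym e
  chain-reach (_∷_ {v = v} refl c) (there z∈) with chain-reach c z∈
  ... | k , reach = suc k , trans (cong (iter k) (step-emb v)) reach

  chain-pairs-linked : ∀ {w} xs → Chain w xs → 2 ∣ length xs → All Linked (pairsOf xs)
  chain-pairs-linked [] [] even = []
  chain-pairs-linked (x ∷ []) c even with () ← ∣1⇒≡1 even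
  chain-pairs-linked (x ∷ y ∷ xs) (_ ∷ (y-after-x ∷ c)) even =
    sym y-after-x ∷ chain-pairs-linked xs c (even-drop-two xs {x} {y} even)

  Live : Alive → Fin n → Set
  Live al u = T (al u)

  follow-chain : ∀ k al ℓ w → Chain w (follow k al ℓ w) × All (Live al) (follow k al ℓ w)
  follow-chain zero al ℓ w = [] , []
  follow-chain (suc k) al ℓ w with splitAt n w in split
  ... | inj₂ _ = [] , []
  ... | inj₁ v with (2 ≤ᵇ headCount al w) ∨ (toℕ v <ᵇ toℕ ℓ) ∨ not (al v) in stop
  ...   | true  = [] , []
  ...   | false =
    (splitAt⁻¹-↑ˡ split ∷ proj₁ rest) ,
    (continue⇒live (2 ≤ᵇ headCount al w) (toℕ v <ᵇ toℕ ℓ) (al v) stop ∷ proj₂ rest)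
    where
      rest : Chain (f v) (follow k al ℓ (f v)) × All (Live al) (follow k al ℓ (f v))
      rest = follow-chain k al ℓ (f v)
      continue⇒live : ∀ a b c → (a ∨ b ∨ not c) ≡ false → T c
      continue⇒live false false true _ = tt

  path-chain : ∀ al ℓ → IsPath (pathFrom al ℓ)
  path-chain al ℓ = proj₁ (follow-chain n al ℓ (f ℓ))

  path-live : ∀ al {ℓ} → Live al ℓ → All (Live al) (pathFrom al ℓ)
  path-live al {ℓ} live = live ∷ proj₂ (follow-chain n al ℓ (f ℓ))

  remove-removes : ∀ p al {u} → u ∈ p → ¬ Live (remove p al) u
  remove-removes (v ∷ p) al {u} u∈ with u ≟ v | u∈
  ... | yes _  | _          = λ ()
  ... | no u≢v | here u≡v   = ⊥-elim (u≢v u≡v)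
  ... | no _   | there u∈p  = remove-removes p al u∈p

  remove-⊆ : ∀ p al {u} → Live (remove p al) u → Live al u
  remove-⊆ [] al live = live
  remove-⊆ (v ∷ p) al {u} live with u ≟ v
  ... | no _ = remove-⊆ p al live

  remove-cases : ∀ p al {u} → Live al u → u ∈ p ⊎ Live (remove p al) u
  remove-cases [] al live = inj₂ live
  remove-cases (v ∷ p) al {u} live with u ≟ v
  ... | yes u≡v = inj₁ (here u≡v)
  ... | no _ with remove-cases p al live
  ...   | inj₁ u∈p = inj₁ (there u∈p)
  ...   | inj₂ live′ = inj₂ live′

  -- the number of live edges, as the size of the corresponding subset of V
  liveSet : Alive → Subset n
  liveSet al = tabulate al

  ∈-liveSet⁺ : ∀ al {u} → Live al u → u ∈ₛ liveSet al
  ∈-liveSet⁺ al {u} live = lookup⇒[]= u (liveSet al) (trans (lookup∘tabulate al u) (to T-≡ live))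

  ∈-liveSet⁻ : ∀ al {u} → u ∈ₛ liveSet al → Live al u
  ∈-liveSet⁻ al {u} u∈ = from T-≡ (trans (sym (lookup∘tabulate al u)) ([]=⇒lookup u∈))

  live-nonempty : ∀ al {u} → Live al u → 1 ≤ ∣ liveSet al ∣
  live-nonempty al {u} live =
    subst (λ m → suc m ≤ ∣ liveSet al ∣) (∣⊥∣≡0 n) (p⊂q⇒∣p∣<∣q∣ (⊥⊆ , u , ∈-liveSet⁺ al live , ∉⊥))

  remove-shrinks : ∀ p al {ℓ} → ℓ ∈ p → Live al ℓ → ∣ liveSet (remove p al) ∣ < ∣ liveSet al ∣
  remove-shrinks p al {ℓ} ℓ∈p live = p⊂q⇒∣p∣<∣q∣
    ( (λ u∈ → ∈-liveSet⁺ al (remove-⊆ p al (∈-liveSet⁻ (remove p al) u∈)))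
    , ℓ , ∈-liveSet⁺ al live , λ ℓ∈ → remove-removes p al ℓ∈p (∈-liveSet⁻ (remove p al) ℓ∈))

  LeafFree : Alive → Set
  LeafFree al = ∀ v → ¬ T (isLeaf al v)

  largestLeaf-live : ∀ al {ℓ} → largestLeaf al ≡ just ℓ → Live al ℓ
  largestLeaf-live al found =
    proj₁ (to T-∧ (proj₂ (∈-filter⁻ (T? ∘ isLeaf al) {xs = allFin n} (last-∈ _ found))))

  largestLeaf-none : ∀ al → largestLeaf al ≡ nothing → LeafFree al
  largestLeaf-none al none v leaf
    with () ← subst (v ∈_) (last-nothing _ none) (∈-filter⁺ (T? ∘ isLeaf al) (∈-allFin v) leaf)

  live-predecessor : ∀ al → LeafFree al → ∀ {v} → Live al v →
    Σ (Fin n) λ u → Live al u × Linked (u , v)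
  live-predecessor al leaf-free {v} live with filter (λ u → T? (al u ∧ (f u == emb v))) (allFin n) in heads
  ... | [] = ⊥-elim (leaf-free v (subst (λ hs → T (al v ∧ (length hs ≤ᵇ 0))) (sym heads) (from T-∧ (live , tt))))
  ... | u ∷ _ with to T-∧ (proj₂ (∈-filter⁻ (λ u → T? (al u ∧ (f u == emb v))) {xs = allFin n}
                                   (subst (u ∈_) (sym heads) (here refl))))
  ...   | live-u , into-v = u , live-u , toWitness into-v

  module _ (acyclic : Acyclic) where

    chain-unique : ∀ {w vs} → Chain w vs → Unique vs
    chain-unique [] = []
    chain-unique (_∷_ {v = v} refl c) =
      All.tabulate (λ z∈ v≡z → repeat z∈ v≡z) ∷ chain-unique c
      where
        repeat : ∀ {z} → z ∈ _ → v ≡ z → ⊥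
        repeat z∈ refl with chain-reach c z∈
        ... | k , reach = acyclic v k (trans (cong (iter k) (step-emb v)) reach)

    path-unique : ∀ {p} → IsPath p → Unique p
    path-unique {ℓ ∷ _} c = chain-unique (refl ∷ c)

    no-backward-walk : (g : ℕ → Fin n) → (∀ k → Linked (g (suc k) , g k)) → ⊥
    no-backward-walk g linked with pigeonhole (n<1+n n) (g ∘ toℕ)
    ... | i , j , i<j , gi≡gj = acyclic (g (toℕ j)) d
      (subst (λ t → iter (suc d) (emb (g t)) ≡ emb (g (toℕ j))) i+d+1≡j
        (trans (walk-back (suc d) (toℕ i)) (cong emb gi≡gj)))
      where
        d = toℕ j ∸ suc (toℕ i)
        i+d+1≡j : suc d + toℕ i ≡ toℕ j
        i+d+1≡j = trans (sym (+-suc d (toℕ i))) (m∸n+n≡m i<j)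
        walk-back : ∀ d i → iter d (emb (g (d + i))) ≡ emb (g i)
        walk-back zero i = refl
        walk-back (suc d) i =
          trans (cong (iter d) (trans (step-emb (g (suc (d + i)))) (linked (d + i)))) (walk-back d i)

    no-leaf⇒dead : ∀ al → largestLeaf al ≡ nothing → ∀ {u} → ¬ Live al u
    no-leaf⇒dead al none {u} live = no-backward-walk (proj₁ ∘ walk) (λ k → proj₂ (proj₂ (back (walk k))))
      where
        back : (x : Σ (Fin n) (Live al)) → Σ (Fin n) λ u → Live al u × Linked (u , proj₁ x)
        back (v , live-v) = live-predecessor al (largestLeaf-none al none) live-v
        walk : ℕ → Σ (Fin n) (Live al)
        walk zero = u , live
        walk (suc k) = let (v , live-v , _) = back (walk k) in v , live-v

    trim-paths : ∀ k al → All IsPath (trimWith k al)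
    trim-paths zero al = []
    trim-paths (suc k) al with largestLeaf al
    ... | nothing = []
    ... | just ℓ = path-chain al ℓ ∷ trim-paths k _

    trim-live : ∀ k al → All (Live al) (concat (trimWith k al))
    trim-live zero al = []
    trim-live (suc k) al with largestLeaf al in found
    ... | nothing = []
    ... | just ℓ = ++⁺ (path-live al (largestLeaf-live al found))
                       (All.map (remove-⊆ (pathFrom al ℓ) al) (trim-live k _))

    trim-unique : ∀ k al → Unique (concat (trimWith k al))
    trim-unique zero al = []
    trim-unique (suc k) al with largestLeaf al
    ... | nothing = []
    ... | just ℓ = unique-++⁺ (path-unique (path-chain al ℓ)) (trim-unique k _)
        λ (u∈p , u∈rest) → remove-removes (pathFrom al ℓ) al u∈p (All.lookup (trim-live k _) u∈rest)

    trim-cover : ∀ k al → ∣ liveSet al ∣ ≤ k → ∀ {u} → Live al u → u ∈ concat (trimWith k al)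
    trim-cover zero al bound live with () ← ≤-trans (live-nonempty al live) bound
    trim-cover (suc k) al bound {u} live with largestLeaf al in found
    ... | nothing = ⊥-elim (no-leaf⇒dead al found live)
    ... | just ℓ with remove-cases (pathFrom al ℓ) al live
    ...   | inj₁ u∈p   = ∈-++⁺ˡ u∈p
    ...   | inj₂ live′ = ∈-++⁺ʳ (pathFrom al ℓ) (trim-cover k _ bound′ live′)
      where
        bound′ : ∣ liveSet (remove (pathFrom al ℓ) al) ∣ ≤ k
        bound′ = ≤-pred (≤-trans (remove-shrinks (pathFrom al ℓ) al (here refl) (largestLeaf-live al found)) bound)

    trimPaths-unique : Unique (concat trimPaths)
    trimPaths-unique = trim-unique n _

    trimPaths-cover : ∀ u → u ∈ concat trimPaths
    trimPaths-cover u = trim-cover n _ (∣p∣≤n (liveSet (λ _ → true))) tt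

-- The matching determined by a pairing of the edges of F

module PairMatching {c ℓ₀ : Level} (K : CommutativeRing c ℓ₀) (n r : ℕ)
  (a : Fin (n + r) → Fin (n + r) → CommutativeRing.Carrier K) (skew : Graphs.SkewSymmetric K a)
  (f : Fin n → Fin (n + r)) (forest : Graphs.SpanningForest K n r a f)
  (ps : List (Fin n × Fin n)) (linked : All (Trimming.Linked n r f) ps)
  (ps-unique : Unique (flat ps)) (ps-cover : ∀ i → i ∈ flat ps) where

  open Forest n r f using (emb; step)
  open Trimming n r f using (step-emb)
  module K = CommutativeRing K
  open import Algebra.Properties.Ring K.ring using (-0#≈0#)

  M₀ : Fin n → Fin n
  M₀ = partner ps

  swaps : ∀ {x y} → (x , y) ∈ ps → M₀ x ≡ y × M₀ y ≡ x
  swaps = partner-pair ps ps-unique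

  first-in-M₀ : ∀ {x y} → (x , y) ∈ ps → f x ≡ emb (M₀ x)
  first-in-M₀ pr∈ = trans (All.lookup linked pr∈) (cong emb (sym (proj₁ (swaps pr∈))))

  -- the edge of the second entry y is not in M₀: it would close the cycle x → y → x
  second-not-in-M₀ : ∀ {x y} → (x , y) ∈ ps → f y ≢ emb (M₀ y)
  second-not-in-M₀ {x} {y} pr∈ y→x = proj₂ forest y 1 (begin
    step (step (emb y))  ≡⟨ cong step (step-emb y) ⟩
    step (f y)           ≡⟨ cong step (trans y→x (cong emb (proj₂ (swaps pr∈)))) ⟩
    step (emb x)         ≡⟨ step-emb x ⟩
    f x                  ≡⟨ All.lookup linked pr∈ ⟩
    emb y                ∎)
    where open ≡-Reasoning

  involution : ∀ i → M₀ (M₀ i) ≡ i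
  involution i with ∈-flat⁻ ps (ps-cover i)
  ... | _ , pr∈ , inj₁ refl = trans (cong M₀ (proj₁ (swaps pr∈))) (proj₂ (swaps pr∈))
  ... | _ , pr∈ , inj₂ refl = trans (cong M₀ (proj₂ (swaps pr∈))) (proj₁ (swaps pr∈))

  -- skew-symmetry makes G^R undirected
  edge-sym : ∀ {i j} → Graphs.Edge K a i j → Graphs.Edge K a j i
  edge-sym (i≢j , aij≉0) = (λ j≡i → i≢j (sym j≡i)) , λ aji≈0 →
    aij≉0 (K.trans (skew _ _) (K.trans (K.-‿cong aji≈0) -0#≈0#))

  pair-edge : ∀ {x y} → (x , y) ∈ ps → Graphs.Edge K a (emb x) (emb y)
  pair-edge {x} pr∈ = subst (Graphs.Edge K a (emb x)) (All.lookup linked pr∈) (proj₁ forest x)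

  matching-edge : ∀ i → Graphs.Edge K a (emb i) (emb (M₀ i))
  matching-edge i with ∈-flat⁻ ps (ps-cover i)
  ... | (x , y) , pr∈ , inj₁ refl = subst (λ t → Graphs.Edge K a (emb x) (emb t)) (sym (proj₁ (swaps pr∈)))
                                      (pair-edge pr∈)
  ... | (x , y) , pr∈ , inj₂ refl = subst (λ t → Graphs.Edge K a (emb y) (emb t)) (sym (proj₂ (swaps pr∈)))
                                      (edge-sym (pair-edge pr∈))

  perfect-matching : Graphs.PerfectMatching K n r a M₀
  perfect-matching = matching-edge , involution

  oriented : ∀ i → (f i ≡ emb (M₀ i)) ⊎ (f (M₀ i) ≡ emb i)
  oriented i with ∈-flat⁻ ps (ps-cover i)
  ... | _ , pr∈ , inj₁ refl = inj₁ (first-in-M₀ pr∈)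
  ... | _ , pr∈ , inj₂ refl = inj₂ (trans (cong f (proj₂ (swaps pr∈))) (All.lookup linked pr∈))

  flat↭allFin : flat ps ↭ allFin n
  flat↭allFin =
    unique-same-elements-↭ ps-unique (allFin⁺ n) (λ {z} _ → ∈-allFin z) (λ {z} _ → ps-cover z)

  n≡2·pairs : n ≡ length ps * 2
  n≡2·pairs = trans (sym (length-tabulate {n = n} (λ i → i)))
                (trans (↭-length (↭-sym flat↭allFin)) (length-flat ps))

  -- exactly the second entries of the pairs carry non-matching edges
  non-matching-count : Graphs.nonMatchingEdges K n r a M₀ f ≡ n / 2
  non-matching-count = begin
    length (filter nonMatching? (allFin n))  ≡⟨ ↭-length (filter-↭ nonMatching? (↭-sym flat↭allFin)) ⟩
    length (filter nonMatching? (flat ps))   ≡⟨ length-filter-flat nonMatching? ps second-entries-only ⟩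
    length ps                                ≡⟨ sym (m*n/n≡m (length ps) 2) ⟩
    length ps * 2 / 2                        ≡⟨ cong (_/ 2) (sym n≡2·pairs) ⟩
    n / 2                                    ∎
    where
      open ≡-Reasoning
      nonMatching? : Decidable (λ i → f i ≢ emb (M₀ i))
      nonMatching? i = ¬? (f i ≟ emb (M₀ i))
      second-entries-only : All (λ pr → ¬ (f (proj₁ pr) ≢ emb (M₀ (proj₁ pr)))
                                        × f (proj₂ pr) ≢ emb (M₀ (proj₂ pr))) ps
      second-entries-only = All.tabulate λ pr∈ → (λ ¬in → ¬in (first-in-M₀ pr∈)) , second-not-in-M₀ pr∈

  compatible : Graphs.Compatible K n r a M₀ f
  compatible = oriented , non-matching-count

-- An even forest F: its trimming paths, cut into pairs, determine M₀ with F ∈ 𝓕(M₀)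

module EvenForest {c ℓ₀ : Level} (K : CommutativeRing c ℓ₀) (n r : ℕ)
  (a : Fin (n + r) → Fin (n + r) → CommutativeRing.Carrier K) (skew : Graphs.SkewSymmetric K a)
  (f : Fin n → Fin (n + r)) (forest : Graphs.SpanningForest K n r a f)
  (even : Forest.AllPathsEven n r f) where

  open Forest n r f using (trimPaths)
  open Trimming n r f

  ps : List (Fin n × Fin n)
  ps = pairsAll trimPaths

  flat-ps : flat ps ≡ concat trimPaths
  flat-ps = flat-pairsAll trimPaths even

  ps-linked : All Linked ps
  ps-linked = linked-all trimPaths (trim-paths (proj₂ forest) n _) even
    where
      linked-all : ∀ qs → All IsPath qs → All (λ q → 2 ∣ length q) qs → All Linked (pairsAll qs)
      linked-all [] [] [] = []
      linked-all ((ℓ ∷ q) ∷ qs) (c ∷ cs) (e ∷ es) =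
        ++⁺ (chain-pairs-linked (ℓ ∷ q) (refl ∷ c) e) (linked-all qs cs es)

  open PairMatching K n r a skew f forest ps ps-linked
    (subst Unique (sym flat-ps) (trimPaths-unique (proj₂ forest)))
    (λ i → subst (i ∈_) (sym flat-ps) (trimPaths-cover (proj₂ forest) i))

  -- an even path ℓ y … contributes the pair (ℓ , y), so it starts in M₀
  starts : All (Graphs.StartsInM K n r a M₀ f) trimPaths
  starts = All.tabulate λ p∈ → start (All.lookup (trim-paths (proj₂ forest) n _) p∈) (All.lookup even p∈)
                                  (pairsOf⊆pairsAll trimPaths p∈)
    where
      start : ∀ {p} → IsPath p → 2 ∣ length p → (∀ {pr} → pr ∈ pairsOf p → pr ∈ ps) →
        Graphs.StartsInM K n r a M₀ f p
      start {ℓ ∷ []} _ odd _ with () ← ∣1⇒≡1 odd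
      start {ℓ ∷ y ∷ _} _ _ pairs⊆ps = first-in-M₀ (pairs⊆ps (here refl))

  matching : Σ (Fin n → Fin n) λ m → Graphs.PerfectMatching K n r a m × Graphs.InFM K n r a m f
  matching = M₀ , perfect-matching , forest , compatible , starts , even

lemma8 : {c ℓ : Level} (K : CommutativeRing c ℓ) (n r : ℕ) → 2 ∣ n → 1 ≤ r →
    (a : Fin (n + r) → Fin (n + r) → CommutativeRing.Carrier K) →
    Graphs.SkewSymmetric K a → Graphs.ZeroRowSums K a →
    (f : Fin n → Fin (n + r)) →
    (Graphs.InF K n r a f → Σ (Fin n → Fin n) (λ m → Graphs.PerfectMatching K n r a m × Graphs.InFM K n r a m f))
    × (Σ (Fin n → Fin n) (λ m → Graphs.PerfectMatching K n r a m × Graphs.InFM K n r a m f) → Graphs.InF K n r a f)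
lemma8 K n r _ _ a skew _ f = forest⇒matched , matched⇒forest
  where
    forest⇒matched : Graphs.InF K n r a f →
      Σ (Fin n → Fin n) (λ m → Graphs.PerfectMatching K n r a m × Graphs.InFM K n r a m f)
    forest⇒matched (forest , even) = EvenForest.matching K n r a skew f forest even
    matched⇒forest : Σ (Fin n → Fin n) (λ m → Graphs.PerfectMatching K n r a m × Graphs.InFM K n r a m f) →
      Graphs.InF K n r a f
    matched⇒forest (_ , _ , forest , _ , _ , even) = forest , even
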